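{- Let $G$ be a non-cyclic abelian $p$-group ($p$ a prime) of order $n$ and exponent $p^m$. Then $\operatorname{sdim}(\mathcal{P}_E(G))=n-m-1$.
   Context: The enhanced power graph $\mathcal{P}_E(G)$ has vertex set $G$, two distinct vertices $x,y$ adjacent iff $\langle x,y\rangle$ is cyclic. For a graph $\Gamma$ and vertices $x,y,z$, $z$ strongly resolves $x$ and $y$ if there is a shortest path from $z$ to $x$ containing $y$ or a shortest path from $z$ to $y$ containing $x$; a strong resolving set is a vertex set $S$ such that every pair of distinct vertices is strongly resolved by some vertex of $S$; $\operatorname{sdim}(\Gamma)$ is the minimum size of a strong resolving set. -}

module Defs where

open import Level using (Level; _⊔_)
open import Algebra.Bundles using (AbelianGroup)
open import Data.Nat using (ℕ; zero; suc; _≤_; _<_)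
open import Data.Fin using (Fin)
open import Data.Fin.Subset using (Subset; _∈_; ∣_∣)
open import Data.List using (List; []; _∷_)
import Data.List.Membership.Propositional as LM
open import Data.Product using (Σ; ∃; ∃-syntax; _×_)
open import Data.Sum using (_⊎_)
open import Relation.Binary.PropositionalEquality using (_≡_; _≢_)
open import Relation.Nullary using (¬_)

module _ {c ℓ : Level} (G : AbelianGroup c ℓ) where
  open AbelianGroup G

  pow : Carrier → ℕ → Carrier
  pow g zero    = ε
  pow g (suc k) = g ∙ pow g k

  record Enumeration (n : ℕ) : Set (c ⊔ ℓ) where
    field
      elem  : Fin n → Carrier
      inj   : ∀ i j → elem i ≈ elem j → i ≡ j
      surj  : ∀ g → ∃[ i ] (elem i ≈ g)

  IsCyclic : Set (c ⊔ ℓ)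
  IsCyclic = ∃[ g ] (∀ h → ∃[ k ] (h ≈ pow g k))

  IsExponent : ℕ → Set (c ⊔ ℓ)
  IsExponent e =
    (0 < e) × (∀ g → pow g e ≈ ε) ×
    (∀ e' → 0 < e' → (∀ g → pow g e' ≈ ε) → e ≤ e')

  -- Since G is abelian, <x , y> = { x^a y^b }, and
  -- (G being finite, hence torsion) natural exponents suffice.
  -- <x , y> is cyclic iff some z ∈ <x , y> generates it, i.e. x, y ∈ <z>.
  CyclicPair : Carrier → Carrier → Set (c ⊔ ℓ)
  CyclicPair x y =
    ∃[ z ] ( (∃[ a ] ∃[ b ] (z ≈ (pow x a ∙ pow y b)))
           × (∃[ a ] (x ≈ pow z a))
           × (∃[ b ] (y ≈ pow z b)) )

module Graph {a : Level} {n : ℕ} (Adj : Fin n → Fin n → Set a) where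

  data Walk : Fin n → Fin n → ℕ → Set a where
    here : ∀ {u} → Walk u u 0
    step : ∀ {u v w k} → Adj u v → Walk v w k → Walk u w (suc k)

  vertices : ∀ {u v k} → Walk u v k → List (Fin n)
  vertices {u} here         = u ∷ []
  vertices {u} (step _ wk)  = u ∷ vertices wk

  -- a shortest path from u to v (a walk of minimum length; such a walk is a path)
  IsShortest : ∀ {u v k} → Walk u v k → Set a
  IsShortest {u} {v} {k} _ = ∀ k' → Walk u v k' → k ≤ k'

  ShortestThrough : Fin n → Fin n → Fin n → Set a
  ShortestThrough z x y =
    ∃[ k ] Σ (Walk z x k) (λ w → IsShortest w × (y LM.∈ vertices w))

  StronglyResolves : Fin n → Fin n → Fin n → Set a
  StronglyResolves z x y = ShortestThrough z x y ⊎ ShortestThrough z y x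

  IsStrongResolvingSet : Subset n → Set a
  IsStrongResolvingSet S =
    ∀ x y → x ≢ y → ∃[ z ] (z ∈ S × StronglyResolves z x y)

  IsSDim : ℕ → Set a
  IsSDim d =
    (∃[ S ] (IsStrongResolvingSet S × ∣ S ∣ ≡ d)) ×
    (∀ S → IsStrongResolvingSet S → d ≤ ∣ S ∣)

module _ {c ℓ : Level} (G : AbelianGroup c ℓ) {n : ℕ} (E : Enumeration G n) where
  open Enumeration E

  EnhancedPowerAdj : Fin n → Fin n → Set (c ⊔ ℓ)
  EnhancedPowerAdj i j = (i ≢ j) × CyclicPair G (elem i) (elem j)

sdimEnhancedPower : ∀ {c ℓ} (G : AbelianGroup c ℓ) {n : ℕ} →
                    Enumeration G n → ℕ → Set (c ⊔ ℓ)
sdimEnhancedPower G E d = Graph.IsSDim (EnhancedPowerAdj G E) d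

{-# OPTIONS --safe #-}
module Submission where

-- Write |x| = p ^ height x.  In an abelian p-group the cyclic subgroups of a cyclic
-- group form a chain, so x and y are adjacent iff one is a power of the other, and
-- the identity is adjacent to every vertex: shortest paths have length at most 2.
-- A vertex z outside {x, y} can strongly resolve x and y only along a geodesic
-- z – y – x, which forces x ∼ y but ⟨x⟩ ≠ ⟨y⟩; comparable elements of equal height
-- generate the same subgroup, so height is injective on the complement of a strong
-- resolving set, which therefore has at most m + 1 elements.  Conversely, take g of
-- order p ^ m and h ∉ ⟨g⟩ of order p.  The element g ^ p ^ j ∙ h lies outside ⟨g⟩,
-- its p-th power is g ^ p ^ (j + 1), and it is not adjacent to g ^ p ^ a for a ≤ j,
-- so it resolves g ^ p ^ a and g ^ p ^ (j + 1): the complement of the chain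
-- { g ^ p ^ k | k ≤ m } is a strong resolving set.

open import Defs
open import Level using (Level; _⊔_)
open import Algebra.Bundles using (AbelianGroup)
open import Data.Nat using (ℕ; zero; suc; pred; _+_; _*_; _∸_; _^_; _≤_; _<_; z≤n; s≤s; NonZero; NonTrivial; nonTrivial⇒n>1)
open import Data.Nat.Properties using (*-comm; +-comm; suc-pred; anyUpTo?; m^n≢0; m^n>0; ^-monoʳ-<; ^-distribˡ-+-*; 1+n≰n; <⇒≱; n<1+n; m≤n⇒∃[o]m+o≡n; +-monoˡ-≤; <-cmp; ≤-pred; ≤-refl; ≤-trans; ≤-reflexive; ≤-antisym; m≤n⇒m≤1+n; ∸-monoʳ-≤; m∸[m∸n]≡n; module ≤-Reasoning)
open import Data.Nat.DivMod using (_%_; _/_; m≡m%n+[m/n]*n; m%n<n)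
open import Data.Nat.Divisibility using (_∣_; _∣?_; divides; quotient; quotient-<; ∣1⇒≡1; ∣-trans)
open import Data.Nat.Coprimality using (Coprime; coprime-Bézout; coprime-divisor)
open import Data.Nat.GCD using (module Bézout)
open import Data.Nat.Primality using (Prime; prime⇒irreducible; prime⇒nonZero; prime⇒nonTrivial)
open import Data.Nat.Induction using (<-rec)
open import Data.Fin using (Fin; zero; suc; toℕ; fromℕ<; punchOut; _≟_)
open import Data.Fin.Properties using (0≢1+n; suc-injective; punchOut-injective; toℕ-injective; toℕ≤pred[n]; fromℕ<-injective; ¬∀⟶∃¬)
open import Data.Fin.Subset using (Subset; _∈_; _∉_; _-_; _∪_; ∁; ⁅_⁆; ⊥; ∣_∣; inside; outside)
open import Data.Fin.Subset.Properties using (_∈?_; ∉⊥; x∈⁅x⁆; x∈⁅y⁆⇒x≡y; x∈p∪q⁺; x∈p∪q⁻; x∈p∧x≢y⇒x∈p-y; x∈p⇒∣p-x∣<∣p∣; x∈∁p⇒x∉p; x∉p⇒x∈∁p; x∉∁p⇒x∈p; ∣∁p∣≡n∸∣p∣; ∣p∣≤n)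
open import Data.Vec using (_∷_; []; here; there)
open import Data.List.Relation.Unary.Any using (here; there)
import Data.List.Membership.Propositional as List
open import Data.Product using (∃; ∃-syntax; Σ; _,_; _×_; proj₁; proj₂; map₂)
open import Data.Sum as Sum using (_⊎_; inj₁; inj₂; [_,_]′)
open import Function using (_∘_)
open import Function.Definitions using (Injective)
open import Relation.Nullary using (¬_; Dec; yes; no; map′; contradiction)
open import Relation.Nullary.Decidable using (_⊎-dec_)
open import Relation.Unary using (Decidable)
open import Relation.Binary using (tri<; tri≈; tri>) renaming (Decidable to Decidable₂)
open import Relation.Binary.PropositionalEquality as ≡ using (_≡_; _≢_)

-- Counting subsets of Fin n

injectiveOn⇒∣p∣≤ : ∀ {n K} (p : Subset n) (f : ∀ {i} → i ∈ p → Fin K) →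
                   (∀ {i j} (i∈p : i ∈ p) (j∈p : j ∈ p) → f i∈p ≡ f j∈p → i ≡ j) →
                   ∣ p ∣ ≤ K
injectiveOn⇒∣p∣≤ []            f f-inj = z≤n
injectiveOn⇒∣p∣≤ (outside ∷ p) f f-inj =
  injectiveOn⇒∣p∣≤ p (f ∘ there) λ i∈p j∈p → suc-injective ∘ f-inj (there i∈p) (there j∈p)
injectiveOn⇒∣p∣≤ {K = zero}  (inside ∷ p) f f-inj with () ← f here
injectiveOn⇒∣p∣≤ {K = suc K} (inside ∷ p) f f-inj =
  s≤s (injectiveOn⇒∣p∣≤ p g λ i∈p j∈p → suc-injective ∘ f-inj (there i∈p) (there j∈p)
                                           ∘ punchOut-injective (f₀≢ i∈p) (f₀≢ j∈p))
  where
  f₀≢ : ∀ {i} (i∈p : i ∈ p) → f here ≢ f (there i∈p)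
  f₀≢ i∈p = 0≢1+n ∘ f-inj here (there i∈p)
  g : ∀ {i} → i ∈ p → Fin K
  g i∈p = punchOut (f₀≢ i∈p)

injective⇒≤∣p∣ : ∀ {n K} (p : Subset n) (f : Fin K → Fin n) → Injective _≡_ _≡_ f →
                 (∀ k → f k ∈ p) → K ≤ ∣ p ∣
injective⇒≤∣p∣ {K = zero}  p f f-inj f∈p = z≤n
injective⇒≤∣p∣ {K = suc K} p f f-inj f∈p =
  ≤-trans (s≤s (injective⇒≤∣p∣ (p - f zero) (f ∘ suc) (suc-injective ∘ f-inj) f∘suc∈))
          (x∈p⇒∣p-x∣<∣p∣ (f∈p zero))
  where
  f∘suc∈ : ∀ k → f (suc k) ∈ p - f zero
  f∘suc∈ k = x∈p∧x≢y⇒x∈p-y (f∈p (suc k)) (0≢1+n ∘ f-inj ∘ ≡.sym)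

image : ∀ {K n} → (Fin K → Fin n) → Subset n
image {zero}  f = ⊥
image {suc K} f = ⁅ f zero ⁆ ∪ image (f ∘ suc)

∈-image⁺ : ∀ {K n} (f : Fin K → Fin n) k → f k ∈ image f
∈-image⁺ f zero    = x∈p∪q⁺ (inj₁ (x∈⁅x⁆ (f zero)))
∈-image⁺ f (suc k) = x∈p∪q⁺ (inj₂ (∈-image⁺ (f ∘ suc) k))

∈-image⁻ : ∀ {K n} (f : Fin K → Fin n) {i} → i ∈ image f → ∃ λ k → i ≡ f k
∈-image⁻ {zero}  f i∈ = contradiction i∈ ∉⊥
∈-image⁻ {suc K} f i∈ with x∈p∪q⁻ ⁅ f zero ⁆ (image (f ∘ suc)) i∈
... | inj₁ i∈⁅f₀⁆ = zero , x∈⁅y⁆⇒x≡y (f zero) i∈⁅f₀⁆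
... | inj₂ i∈img with k , i≡ ← ∈-image⁻ (f ∘ suc) i∈img = suc k , i≡

least : ∀ {a} {P : ℕ → Set a} → Decidable P → ∀ {n} → P n →
        ∃ λ k → P k × (∀ {j} → P j → k ≤ j)
least P? {zero}  P0 = 0 , P0 , λ _ → z≤n
least P? {suc n} Pn with P? 0
... | yes P0 = 0 , P0 , λ _ → z≤n
... | no ¬P0 with k , Pk , minimal ← least (P? ∘ suc) Pn =
  suc k , Pk , λ { {zero} P0 → contradiction P0 ¬P0 ; {suc j} Pj → s≤s (minimal Pj) }

¬∣⇒coprime-^ : ∀ {p a} → Prime p → ¬ p ∣ a → ∀ m → Coprime a (p ^ m)
¬∣⇒coprime-^ _ _ zero (_ , d∣1) = ∣1⇒≡1 d∣1
¬∣⇒coprime-^ {p} {a} p-prime p∤a (suc m) {d} (d∣a , d∣p*p^m) =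
  ¬∣⇒coprime-^ p-prime p∤a m (d∣a , coprime-divisor d⊥p d∣p*p^m)
  where
  d⊥p : Coprime d p
  d⊥p (e∣d , e∣p) with prime⇒irreducible p-prime e∣p
  ... | inj₁ e≡1    = e≡1
  ... | inj₂ ≡.refl = contradiction (∣-trans e∣d d∣a) p∤a

-- Cyclic subgroups of an abelian group

module CyclicSubgroups {c ℓ : Level} (G : AbelianGroup c ℓ) where
  open AbelianGroup G
  open import Algebra.Properties.CommutativeMonoid.Mult commutativeMonoid renaming (_×_ to _·_)
  open import Algebra.Properties.AbelianGroup G using (xyx⁻¹≈y)
  open import Algebra.Properties.Group group using (inverseˡ-unique; inverseʳ-unique; identityˡ-unique)
  open import Relation.Binary.Reasoning.Setoid setoid

  infixr 8 _^ᴳ_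
  _^ᴳ_ : Carrier → ℕ → Carrier
  x ^ᴳ k = pow G x k

  private
    ^ᴳ≡· : ∀ x k → x ^ᴳ k ≡ k · x
    ^ᴳ≡· x zero    = ≡.refl
    ^ᴳ≡· x (suc k) = ≡.cong (x ∙_) (^ᴳ≡· x k)

  ^ᴳ-congˡ : ∀ {x y} k → x ≈ y → x ^ᴳ k ≈ y ^ᴳ k
  ^ᴳ-congˡ {x} {y} k x≈y rewrite ^ᴳ≡· x k | ^ᴳ≡· y k = ×-congʳ k x≈y

  ^ᴳ-congʳ : ∀ x {a b} → a ≡ b → x ^ᴳ a ≈ x ^ᴳ b
  ^ᴳ-congʳ x ≡.refl = refl

  ^ᴳ-1 : ∀ x → x ^ᴳ 1 ≈ x
  ^ᴳ-1 = identityʳ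

  ^ᴳ-+ : ∀ x a b → x ^ᴳ (a + b) ≈ x ^ᴳ a ∙ x ^ᴳ b
  ^ᴳ-+ x a b rewrite ^ᴳ≡· x (a + b) | ^ᴳ≡· x a | ^ᴳ≡· x b = ×-homo-+ x a b

  ^ᴳ-* : ∀ x a b → x ^ᴳ (a * b) ≈ (x ^ᴳ a) ^ᴳ b
  ^ᴳ-* x a b rewrite ^ᴳ≡· x (a * b) | ^ᴳ≡· (x ^ᴳ a) b | ^ᴳ≡· x a = begin
    (a * b) · x  ≡⟨ ≡.cong (_· x) (*-comm a b) ⟩
    (b * a) · x  ≈⟨ ×-assocˡ x b a ⟨
    b · (a · x)  ∎

  ^ᴳ-distrib-∙ : ∀ x y k → (x ∙ y) ^ᴳ k ≈ x ^ᴳ k ∙ y ^ᴳ k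
  ^ᴳ-distrib-∙ x y k rewrite ^ᴳ≡· (x ∙ y) k | ^ᴳ≡· x k | ^ᴳ≡· y k = ×-distrib-+ x y k

  ε^ᴳ : ∀ k → ε ^ᴳ k ≈ ε
  ε^ᴳ zero    = refl
  ε^ᴳ (suc k) = trans (identityˡ _) (ε^ᴳ k)

  ^ᴳ-^+ : ∀ x q a b → x ^ᴳ (q ^ (a + b)) ≈ (x ^ᴳ (q ^ a)) ^ᴳ (q ^ b)
  ^ᴳ-^+ x q a b = trans (^ᴳ-congʳ x (^-distribˡ-+-* q a b)) (^ᴳ-* x (q ^ a) (q ^ b))

  ^ᴳ-∣ : ∀ w {q a} (q∣a : q ∣ a) → w ^ᴳ a ≈ (w ^ᴳ q) ^ᴳ quotient q∣a
  ^ᴳ-∣ w {q} (divides b a≡b*q) = trans (^ᴳ-congʳ w (≡.trans a≡b*q (*-comm b q))) (^ᴳ-* w q b)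

  infix 4 _∈⟨_⟩
  _∈⟨_⟩ : Carrier → Carrier → Set ℓ
  x ∈⟨ y ⟩ = ∃ λ k → x ≈ y ^ᴳ k

  ∈⟨⟩-refl : ∀ x → x ∈⟨ x ⟩
  ∈⟨⟩-refl x = 1 , sym (^ᴳ-1 x)

  ε∈⟨⟩ : ∀ y → ε ∈⟨ y ⟩
  ε∈⟨⟩ y = 0 , refl

  ^ᴳ∈⟨⟩ : ∀ y k → y ^ᴳ k ∈⟨ y ⟩
  ^ᴳ∈⟨⟩ y k = k , refl

  ∈⟨⟩-trans : ∀ {x y z} → x ∈⟨ y ⟩ → y ∈⟨ z ⟩ → x ∈⟨ z ⟩
  ∈⟨⟩-trans {x} {y} {z} (a , x≈) (b , y≈) = b * a , (begin
    x              ≈⟨ x≈ ⟩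
    y ^ᴳ a         ≈⟨ ^ᴳ-congˡ a y≈ ⟩
    (z ^ᴳ b) ^ᴳ a  ≈⟨ ^ᴳ-* z b a ⟨
    z ^ᴳ (b * a)   ∎)

  ∈⟨⟩-resp : ∀ {x x′ y y′} → x ≈ x′ → y ≈ y′ → x ∈⟨ y ⟩ → x′ ∈⟨ y′ ⟩
  ∈⟨⟩-resp x≈x′ y≈y′ (a , x≈) = a , trans (sym x≈x′) (trans x≈ (^ᴳ-congˡ a y≈y′))

  ∈⟨⟩-respˡ : ∀ {x x′ y} → x ≈ x′ → x ∈⟨ y ⟩ → x′ ∈⟨ y ⟩
  ∈⟨⟩-respˡ x≈x′ = ∈⟨⟩-resp x≈x′ refl

  ∈⟨⟩-respʳ : ∀ {x y y′} → y ≈ y′ → x ∈⟨ y ⟩ → x ∈⟨ y′ ⟩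
  ∈⟨⟩-respʳ = ∈⟨⟩-resp refl

  ^ᴳ-∈⟨⟩ : ∀ {x y} k → x ∈⟨ y ⟩ → x ^ᴳ k ∈⟨ y ⟩
  ^ᴳ-∈⟨⟩ {x} k = ∈⟨⟩-trans (^ᴳ∈⟨⟩ x k)

  ∙-∈⟨⟩ : ∀ {x y z} → x ∈⟨ z ⟩ → y ∈⟨ z ⟩ → x ∙ y ∈⟨ z ⟩
  ∙-∈⟨⟩ {z = z} (a , x≈) (b , y≈) = a + b , trans (∙-cong x≈ y≈) (sym (^ᴳ-+ z a b))

  ^ᴳ-∈⟨^ᴳ⟩ : ∀ {x y} k → x ∈⟨ y ⟩ → x ^ᴳ k ∈⟨ y ^ᴳ k ⟩
  ^ᴳ-∈⟨^ᴳ⟩ {x} {y} k (a , x≈) = a , (begin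
    x ^ᴳ k          ≈⟨ ^ᴳ-congˡ k x≈ ⟩
    (y ^ᴳ a) ^ᴳ k   ≈⟨ ^ᴳ-* y a k ⟨
    y ^ᴳ (a * k)    ≡⟨ ≡.cong (y ^ᴳ_) (*-comm a k) ⟩
    y ^ᴳ (k * a)    ≈⟨ ^ᴳ-* y k a ⟩
    (y ^ᴳ k) ^ᴳ a   ∎)

  ^ᴳ^-∈⟨^ᴳ^⟩ : ∀ x q {a b} → a ≤ b → x ^ᴳ (q ^ b) ∈⟨ x ^ᴳ (q ^ a) ⟩
  ^ᴳ^-∈⟨^ᴳ^⟩ x q {a} a≤b with e , a+e≡b ← m≤n⇒∃[o]m+o≡n a≤b =
    q ^ e , trans (^ᴳ-congʳ x (≡.cong (q ^_) (≡.sym a+e≡b))) (^ᴳ-^+ x q a e)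

  ∈⟨ε⟩⇒≈ε : ∀ {x} → x ∈⟨ ε ⟩ → x ≈ ε
  ∈⟨ε⟩⇒≈ε (a , x≈) = trans x≈ (ε^ᴳ a)

  ∈⟨⟩⇒cyclicPair : ∀ {x y} → x ∈⟨ y ⟩ → CyclicPair G x y
  ∈⟨⟩⇒cyclicPair {y = y} x∈⟨y⟩ =
    y , (0 , 1 , sym (trans (identityˡ _) (^ᴳ-1 y))) , x∈⟨y⟩ , ∈⟨⟩-refl y

  cyclicPair-sym : ∀ {x y} → CyclicPair G x y → CyclicPair G y x
  cyclicPair-sym (w , (a , b , w≈) , x∈ , y∈) = w , (b , a , trans w≈ (comm _ _)) , y∈ , x∈

  cyclicPair-resp : ∀ {x x′ y y′} → x ≈ x′ → y ≈ y′ → CyclicPair G x y → CyclicPair G x′ y′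
  cyclicPair-resp x≈ y≈ (w , (a , b , w≈) , x∈ , y∈) =
    w , (a , b , trans w≈ (∙-cong (^ᴳ-congˡ a x≈) (^ᴳ-congˡ b y≈))) ,
    ∈⟨⟩-respˡ x≈ x∈ , ∈⟨⟩-respˡ y≈ y∈

  cyclicPair-twin : ∀ {x y z} → y ∈⟨ x ⟩ → x ∈⟨ y ⟩ → CyclicPair G z y → CyclicPair G z x
  cyclicPair-twin {x} {y} {z} (l , y≈) x∈⟨y⟩ (w , (a , b , w≈) , z∈ , y∈) =
    w , (a , l * b , w≈′) , z∈ , ∈⟨⟩-trans x∈⟨y⟩ y∈
    where
    w≈′ : w ≈ z ^ᴳ a ∙ x ^ᴳ (l * b)
    w≈′ = begin
      w                       ≈⟨ w≈ ⟩
      z ^ᴳ a ∙ y ^ᴳ b         ≈⟨ ∙-congˡ (^ᴳ-congˡ b y≈) ⟩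
      z ^ᴳ a ∙ (x ^ᴳ l) ^ᴳ b  ≈⟨ ∙-congˡ (^ᴳ-* x l b) ⟨
      z ^ᴳ a ∙ x ^ᴳ (l * b)   ∎

  module Torsion (N : ℕ) .{{_ : NonZero N}} (torsion : ∀ x → x ^ᴳ N ≈ ε) where

    ^ᴳ-*N : ∀ x k → x ^ᴳ (k * N) ≈ ε
    ^ᴳ-*N x k = trans (^ᴳ-* x k N) (torsion (x ^ᴳ k))

    ^ᴳ-%N : ∀ x k → x ^ᴳ k ≈ x ^ᴳ (k % N)
    ^ᴳ-%N x k = begin
      x ^ᴳ k                            ≡⟨ ≡.cong (x ^ᴳ_) (m≡m%n+[m/n]*n k N) ⟩
      x ^ᴳ (k % N + k / N * N)          ≈⟨ ^ᴳ-+ x (k % N) (k / N * N) ⟩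
      x ^ᴳ (k % N) ∙ x ^ᴳ (k / N * N)   ≈⟨ ∙-congˡ (^ᴳ-*N x (k / N)) ⟩
      x ^ᴳ (k % N) ∙ ε                  ≈⟨ identityʳ _ ⟩
      x ^ᴳ (k % N)                      ∎

    ∈⟨⟩? : Decidable₂ _≈_ → ∀ x y → Dec (x ∈⟨ y ⟩)
    ∈⟨⟩? _≈?_ x y = map′ (λ (k , _ , x≈) → k , x≈)
                         (λ (k , x≈) → k % N , m%n<n k N , trans x≈ (^ᴳ-%N y k))
                         (anyUpTo? (λ k → x ≈? (y ^ᴳ k)) N)

    ⁻¹-∈⟨⟩ : ∀ {x y} → x ∈⟨ y ⟩ → x ⁻¹ ∈⟨ y ⟩
    ⁻¹-∈⟨⟩ {x} x∈ = ∈⟨⟩-respˡ x^[N-1]≈x⁻¹ (^ᴳ-∈⟨⟩ (pred N) x∈)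
      where
      x^[N-1]≈x⁻¹ : x ^ᴳ pred N ≈ x ⁻¹
      x^[N-1]≈x⁻¹ = inverseʳ-unique x (x ^ᴳ pred N) (trans (^ᴳ-congʳ x (suc-pred N)) (torsion x))

    coprime⇒∈⟨^ᴳ⟩ : ∀ {a} → Coprime a N → ∀ w → w ∈⟨ w ^ᴳ a ⟩
    coprime⇒∈⟨^ᴳ⟩ {a} a⊥N w with coprime-Bézout a⊥N
    ... | Bézout.+- u v 1+vN≡ua = u , (begin
      w                  ≈⟨ identityʳ w ⟨
      w ∙ ε              ≈⟨ ∙-congˡ (^ᴳ-*N w v) ⟨
      w ^ᴳ (1 + v * N)   ≡⟨ ≡.cong (w ^ᴳ_) (≡.trans 1+vN≡ua (*-comm u a)) ⟩
      w ^ᴳ (a * u)       ≈⟨ ^ᴳ-* w a u ⟩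
      (w ^ᴳ a) ^ᴳ u      ∎)
    ... | Bézout.-+ u v 1+ua≡vN = ∈⟨⟩-respˡ (sym w≈) (⁻¹-∈⟨⟩ (^ᴳ∈⟨⟩ (w ^ᴳ a) u))
      where
      w≈ : w ≈ ((w ^ᴳ a) ^ᴳ u) ⁻¹
      w≈ = inverseˡ-unique w ((w ^ᴳ a) ^ᴳ u) (begin
        w ∙ (w ^ᴳ a) ^ᴳ u   ≈⟨ ∙-congˡ (^ᴳ-* w a u) ⟨
        w ^ᴳ (1 + a * u)    ≡⟨ ≡.cong (λ k → w ^ᴳ (1 + k)) (*-comm a u) ⟩
        w ^ᴳ (1 + u * a)    ≡⟨ ≡.cong (w ^ᴳ_) 1+ua≡vN ⟩
        w ^ᴳ (v * N)        ≈⟨ ^ᴳ-*N w v ⟩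
        ε                   ∎)

  module PGroup (p : ℕ) (p-prime : Prime p) (m : ℕ) (torsion : ∀ x → x ^ᴳ (p ^ m) ≈ ε) where

    instance
      p≢0 : NonZero p
      p≢0 = prime⇒nonZero p-prime
      p-nontrivial : NonTrivial p
      p-nontrivial = prime⇒nonTrivial p-prime
      p^m≢0 : NonZero (p ^ m)
      p^m≢0 = m^n≢0 p m

    open Torsion (p ^ m) torsion public

    ¬∣⇒∈⟨^ᴳ⟩ : ∀ {a} → ¬ p ∣ a → ∀ w → w ∈⟨ w ^ᴳ a ⟩
    ¬∣⇒∈⟨^ᴳ⟩ p∤a = coprime⇒∈⟨^ᴳ⟩ (¬∣⇒coprime-^ p-prime p∤a m)

    ^ᴳp^≥m≈ε : ∀ x {k} → m ≤ k → x ^ᴳ (p ^ k) ≈ ε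
    ^ᴳp^≥m≈ε x {k} m≤k with e , m+e≡k ← m≤n⇒∃[o]m+o≡n m≤k = begin
      x ^ᴳ (p ^ k)                ≡⟨ ≡.cong (λ k → x ^ᴳ (p ^ k)) m+e≡k ⟨
      x ^ᴳ (p ^ (m + e))          ≈⟨ ^ᴳ-^+ x p m e ⟩
      (x ^ᴳ (p ^ m)) ^ᴳ (p ^ e)   ≈⟨ ^ᴳ-congˡ (p ^ e) (torsion x) ⟩
      ε ^ᴳ (p ^ e)                ≈⟨ ε^ᴳ (p ^ e) ⟩
      ε                           ∎

    -- If p ∤ a then w^a generates ⟨w⟩; otherwise both powers lie in ⟨w^p⟩ with smaller exponents.
    powers-comparable : ∀ a b w → w ^ᴳ a ∈⟨ w ^ᴳ b ⟩ ⊎ w ^ᴳ b ∈⟨ w ^ᴳ a ⟩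
    powers-comparable = <-rec _ step
      where
      step : ∀ a → (∀ {a′} → a′ < a → ∀ b w → w ^ᴳ a′ ∈⟨ w ^ᴳ b ⟩ ⊎ w ^ᴳ b ∈⟨ w ^ᴳ a′ ⟩) →
             ∀ b w → w ^ᴳ a ∈⟨ w ^ᴳ b ⟩ ⊎ w ^ᴳ b ∈⟨ w ^ᴳ a ⟩
      step zero _ b w = inj₁ (ε∈⟨⟩ _)
      step a@(suc _) rec b w with p ∣? a | p ∣? b
      ... | no p∤a  | _       = inj₂ (∈⟨⟩-trans (^ᴳ∈⟨⟩ w b) (¬∣⇒∈⟨^ᴳ⟩ p∤a w))
      ... | yes _   | no p∤b  = inj₁ (∈⟨⟩-trans (^ᴳ∈⟨⟩ w a) (¬∣⇒∈⟨^ᴳ⟩ p∤b w))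
      ... | yes p∣a | yes p∣b =
        Sum.map (∈⟨⟩-resp wᵃ≈ wᵇ≈) (∈⟨⟩-resp wᵇ≈ wᵃ≈) (rec (quotient-< p∣a) (quotient p∣b) (w ^ᴳ p))
        where
        wᵃ≈ : (w ^ᴳ p) ^ᴳ quotient p∣a ≈ w ^ᴳ a
        wᵃ≈ = sym (^ᴳ-∣ w p∣a)
        wᵇ≈ : (w ^ᴳ p) ^ᴳ quotient p∣b ≈ w ^ᴳ b
        wᵇ≈ = sym (^ᴳ-∣ w p∣b)

    cyclicPair⇒comparable : ∀ {x y} → CyclicPair G x y → x ∈⟨ y ⟩ ⊎ y ∈⟨ x ⟩
    cyclicPair⇒comparable (w , _ , (a , x≈) , (b , y≈)) =
      Sum.map (∈⟨⟩-resp (sym x≈) (sym y≈)) (∈⟨⟩-resp (sym y≈) (sym x≈)) (powers-comparable a b w)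

    module Height (_≈?_ : Decidable₂ _≈_) where

      private
        leastAnnihilator : ∀ x → ∃ λ k → x ^ᴳ (p ^ k) ≈ ε × (∀ {j} → x ^ᴳ (p ^ j) ≈ ε → k ≤ j)
        leastAnnihilator x = least (λ k → (x ^ᴳ (p ^ k)) ≈? ε) {m} (torsion x)

      -- the order of x is p ^ height x
      height : Carrier → ℕ
      height x = proj₁ (leastAnnihilator x)

      height-annihilates : ∀ x → x ^ᴳ (p ^ height x) ≈ ε
      height-annihilates x = proj₁ (proj₂ (leastAnnihilator x))

      height-minimal : ∀ x {j} → x ^ᴳ (p ^ j) ≈ ε → height x ≤ j
      height-minimal x = proj₂ (proj₂ (leastAnnihilator x))

      height≤m : ∀ x → height x ≤ m
      height≤m x = height-minimal x (torsion x)

      height≡0⇒≈ε : ∀ {x} → height x ≡ 0 → x ≈ ε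
      height≡0⇒≈ε {x} hx≡0 = begin
        x                     ≈⟨ ^ᴳ-1 x ⟨
        x ^ᴳ (p ^ 0)          ≡⟨ ≡.cong (λ k → x ^ᴳ (p ^ k)) hx≡0 ⟨
        x ^ᴳ (p ^ height x)   ≈⟨ height-annihilates x ⟩
        ε                     ∎

      ∈⟨^ᴳp⟩⇒height≤ : ∀ {x y k} → x ∈⟨ y ^ᴳ p ⟩ → height y ≡ suc k → height x ≤ k
      ∈⟨^ᴳp⟩⇒height≤ {x} {y} {k} x∈ hy≡ =
        height-minimal x (∈⟨ε⟩⇒≈ε (∈⟨⟩-respʳ yᵖ^pᵏ≈ε (^ᴳ-∈⟨^ᴳ⟩ (p ^ k) x∈)))
        where
        yᵖ^pᵏ≈ε : (y ^ᴳ p) ^ᴳ (p ^ k) ≈ ε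
        yᵖ^pᵏ≈ε = begin
          (y ^ᴳ p) ^ᴳ (p ^ k)   ≈⟨ ^ᴳ-* y p (p ^ k) ⟨
          y ^ᴳ (p ^ suc k)      ≡⟨ ≡.cong (λ j → y ^ᴳ (p ^ j)) hy≡ ⟨
          y ^ᴳ (p ^ height y)   ≈⟨ height-annihilates y ⟩
          ε                     ∎

      ∈⟨⟩∧height≡⇒∈⟨⟩ : ∀ {x y} → x ∈⟨ y ⟩ → height x ≡ height y → y ∈⟨ x ⟩
      ∈⟨⟩∧height≡⇒∈⟨⟩ {x} {y} (a , x≈) hx≡hy with p ∣? a | height y in hy≡
      ... | no p∤a  | _     = ∈⟨⟩-respʳ (sym x≈) (¬∣⇒∈⟨^ᴳ⟩ p∤a y)
      ... | yes _   | zero  = ∈⟨⟩-respˡ (sym (height≡0⇒≈ε hy≡)) (ε∈⟨⟩ x)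
      ... | yes p∣a | suc k = contradiction
        (≡.subst (_≤ k) hx≡hy (∈⟨^ᴳp⟩⇒height≤ (quotient p∣a , trans x≈ (^ᴳ-∣ y p∣a)) hy≡)) 1+n≰n

      cyclicPair∧height≡⇒twins : ∀ {x y} → CyclicPair G x y → height x ≡ height y →
                                 x ∈⟨ y ⟩ × y ∈⟨ x ⟩
      cyclicPair∧height≡⇒twins cp hx≡hy with cyclicPair⇒comparable cp
      ... | inj₁ x∈⟨y⟩ = x∈⟨y⟩ , ∈⟨⟩∧height≡⇒∈⟨⟩ x∈⟨y⟩ hx≡hy
      ... | inj₂ y∈⟨x⟩ = ∈⟨⟩∧height≡⇒∈⟨⟩ y∈⟨x⟩ (≡.sym hx≡hy) , y∈⟨x⟩

  module MaximalChain (p : ℕ) (p-prime : Prime p) (m′ : ℕ)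
                      (torsion : ∀ x → x ^ᴳ (p ^ suc m′) ≈ ε)
                      (g : Carrier) (g-maximal : ¬ g ^ᴳ (p ^ m′) ≈ ε) where
    open PGroup p p-prime (suc m′) torsion

    chain-strict : ∀ {a b} → a ≤ m′ → a < b → ¬ g ^ᴳ (p ^ a) ∈⟨ g ^ᴳ (p ^ b) ⟩
    chain-strict {a} {b} a≤m′ a<b gᵖᵃ∈ with d , a+d≡m′ ← m≤n⇒∃[o]m+o≡n a≤m′ =
      g-maximal (∈⟨ε⟩⇒≈ε (∈⟨⟩-resp gᵖᵃ^pᵈ≈ gᵖᵇ^pᵈ≈ε (^ᴳ-∈⟨^ᴳ⟩ (p ^ d) gᵖᵃ∈)))
      where
      gᵖᵃ^pᵈ≈ : (g ^ᴳ (p ^ a)) ^ᴳ (p ^ d) ≈ g ^ᴳ (p ^ m′)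
      gᵖᵃ^pᵈ≈ = trans (sym (^ᴳ-^+ g p a d)) (^ᴳ-congʳ g (≡.cong (p ^_) a+d≡m′))
      1+m′≤b+d : suc m′ ≤ b + d
      1+m′≤b+d = ≡.subst (_≤ b + d) (≡.cong suc a+d≡m′) (+-monoˡ-≤ d a<b)
      gᵖᵇ^pᵈ≈ε : (g ^ᴳ (p ^ b)) ^ᴳ (p ^ d) ≈ ε
      gᵖᵇ^pᵈ≈ε = trans (sym (^ᴳ-^+ g p b d)) (^ᴳp^≥m≈ε g 1+m′≤b+d)

    chain-injective : ∀ {a b} → a ≤ suc m′ → b ≤ suc m′ → g ^ᴳ (p ^ a) ≈ g ^ᴳ (p ^ b) → a ≡ b
    chain-injective {a} {b} a≤m b≤m gᵖᵃ≈gᵖᵇ with <-cmp a b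
    ... | tri≈ _ a≡b _ = a≡b
    ... | tri< a<b _ _ = contradiction (∈⟨⟩-respˡ (sym gᵖᵃ≈gᵖᵇ) (∈⟨⟩-refl _))
                           (chain-strict (≤-pred (≤-trans a<b b≤m)) a<b)
    ... | tri> _ _ b<a = contradiction (∈⟨⟩-respˡ gᵖᵃ≈gᵖᵇ (∈⟨⟩-refl _))
                           (chain-strict (≤-pred (≤-trans b<a a≤m)) b<a)

    pthPower∈⟨g⟩⇒∃orderP : ∀ {y} → ¬ y ∈⟨ g ⟩ → y ^ᴳ p ∈⟨ g ⟩ → ∃ λ h → h ^ᴳ p ≈ ε × ¬ h ∈⟨ g ⟩
    pthPower∈⟨g⟩⇒∃orderP {y} y∉ (a , yᵖ≈) with p ∣? a
    ... | no p∤a = contradiction (∈⟨ε⟩⇒≈ε (∈⟨⟩-respʳ yᵖ^pᵐ′≈ε (^ᴳ-∈⟨^ᴳ⟩ (p ^ m′) g∈⟨yᵖ⟩))) g-maximal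
      where
      g∈⟨yᵖ⟩ : g ∈⟨ y ^ᴳ p ⟩
      g∈⟨yᵖ⟩ = ∈⟨⟩-respʳ (sym yᵖ≈) (¬∣⇒∈⟨^ᴳ⟩ p∤a g)
      yᵖ^pᵐ′≈ε : (y ^ᴳ p) ^ᴳ (p ^ m′) ≈ ε
      yᵖ^pᵐ′≈ε = trans (sym (^ᴳ-* y p (p ^ m′))) (torsion y)
    ... | yes p∣a = h , hᵖ≈ε , h∉
      where
      b : ℕ
      b = quotient p∣a
      h : Carrier
      h = y ∙ (g ^ᴳ b) ⁻¹
      h∙gᵇ≈y : h ∙ g ^ᴳ b ≈ y
      h∙gᵇ≈y = trans (assoc _ _ _) (trans (∙-congˡ (inverseˡ _)) (identityʳ y))
      hᵖ≈ε : h ^ᴳ p ≈ ε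
      hᵖ≈ε = identityˡ-unique (h ^ᴳ p) ((g ^ᴳ b) ^ᴳ p) (begin
        h ^ᴳ p ∙ (g ^ᴳ b) ^ᴳ p   ≈⟨ ^ᴳ-distrib-∙ h (g ^ᴳ b) p ⟨
        (h ∙ g ^ᴳ b) ^ᴳ p        ≈⟨ ^ᴳ-congˡ p h∙gᵇ≈y ⟩
        y ^ᴳ p                   ≈⟨ yᵖ≈ ⟩
        g ^ᴳ a                   ≈⟨ ^ᴳ-∣ g p∣a ⟩
        (g ^ᴳ p) ^ᴳ b            ≈⟨ ^ᴳ-* g p b ⟨
        g ^ᴳ (p * b)             ≡⟨ ≡.cong (g ^ᴳ_) (*-comm p b) ⟩
        g ^ᴳ (b * p)             ≈⟨ ^ᴳ-* g b p ⟩
        (g ^ᴳ b) ^ᴳ p            ∎)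
      h∉ : ¬ h ∈⟨ g ⟩
      h∉ h∈ = y∉ (∈⟨⟩-respˡ h∙gᵇ≈y (∙-∈⟨⟩ h∈ (^ᴳ∈⟨⟩ g b)))

    module _ (_≈?_ : Decidable₂ _≈_) where

      ∉⟨g⟩⇒∃pthPower∈⟨g⟩ : ∀ {y} → ¬ y ∈⟨ g ⟩ → ∃ λ y′ → ¬ y′ ∈⟨ g ⟩ × y′ ^ᴳ p ∈⟨ g ⟩
      ∉⟨g⟩⇒∃pthPower∈⟨g⟩ {y} y∉ with least (λ j → ∈⟨⟩? _≈?_ (y ^ᴳ (p ^ j)) g) {suc m′}
                                            (∈⟨⟩-respˡ (sym (torsion y)) (ε∈⟨⟩ g))
      ... | zero , y^p⁰∈ , _ = contradiction (∈⟨⟩-respˡ (^ᴳ-1 y) y^p⁰∈) y∉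
      ... | suc j , y^pʲ⁺¹∈ , minimal =
        y ^ᴳ (p ^ j) , (λ y^pʲ∈ → 1+n≰n (minimal y^pʲ∈)) , ∈⟨⟩-respˡ y^pʲ⁺¹≈ y^pʲ⁺¹∈
        where
        y^pʲ⁺¹≈ : y ^ᴳ (p ^ suc j) ≈ (y ^ᴳ (p ^ j)) ^ᴳ p
        y^pʲ⁺¹≈ = trans (^ᴳ-congʳ y (*-comm p (p ^ j))) (^ᴳ-* y (p ^ j) p)

      ∉⟨g⟩⇒∃orderP : ∀ {y} → ¬ y ∈⟨ g ⟩ → ∃ λ h → h ^ᴳ p ≈ ε × ¬ h ∈⟨ g ⟩
      ∉⟨g⟩⇒∃orderP y∉ with _ , y′∉ , y′ᵖ∈ ← ∉⟨g⟩⇒∃pthPower∈⟨g⟩ y∉ = pthPower∈⟨g⟩⇒∃orderP y′∉ y′ᵖ∈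

    module Witness {h : Carrier} (hᵖ≈ε : h ^ᴳ p ≈ ε) (h∉⟨g⟩ : ¬ h ∈⟨ g ⟩) where

      witness : ℕ → Carrier
      witness j = g ^ᴳ (p ^ j) ∙ h

      witness∉⟨g⟩ : ∀ j → ¬ witness j ∈⟨ g ⟩
      witness∉⟨g⟩ j w∈ =
        h∉⟨g⟩ (∈⟨⟩-respˡ (xyx⁻¹≈y _ h) (∙-∈⟨⟩ w∈ (⁻¹-∈⟨⟩ (^ᴳ∈⟨⟩ g (p ^ j)))))

      witness^p : ∀ j → witness j ^ᴳ p ≈ g ^ᴳ (p ^ suc j)
      witness^p j = begin
        (g ^ᴳ (p ^ j) ∙ h) ^ᴳ p        ≈⟨ ^ᴳ-distrib-∙ (g ^ᴳ (p ^ j)) h p ⟩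
        (g ^ᴳ (p ^ j)) ^ᴳ p ∙ h ^ᴳ p   ≈⟨ ∙-congˡ hᵖ≈ε ⟩
        (g ^ᴳ (p ^ j)) ^ᴳ p ∙ ε        ≈⟨ identityʳ _ ⟩
        (g ^ᴳ (p ^ j)) ^ᴳ p            ≈⟨ ^ᴳ-* g (p ^ j) p ⟨
        g ^ᴳ (p ^ j * p)               ≡⟨ ≡.cong (g ^ᴳ_) (*-comm (p ^ j) p) ⟩
        g ^ᴳ (p ^ suc j)               ∎

      witness-nonadjacent : ∀ {a j} → a ≤ j → j ≤ m′ → ¬ CyclicPair G (witness j) (g ^ᴳ (p ^ a))
      witness-nonadjacent {a} {j} a≤j j≤m′ cp with cyclicPair⇒comparable cp
      ... | inj₁ w∈ = witness∉⟨g⟩ j (∈⟨⟩-trans w∈ (^ᴳ∈⟨⟩ g (p ^ a)))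
      ... | inj₂ (c , gᵖᵃ≈) with p ∣? c
      ...   | no p∤c  = witness∉⟨g⟩ j
                          (∈⟨⟩-trans (∈⟨⟩-respʳ (sym gᵖᵃ≈) (¬∣⇒∈⟨^ᴳ⟩ p∤c (witness j))) (^ᴳ∈⟨⟩ g (p ^ a)))
      ...   | yes p∣c = chain-strict (≤-trans a≤j j≤m′) (s≤s a≤j)
                          (quotient p∣c , trans gᵖᵃ≈ (trans (^ᴳ-∣ (witness j) p∣c)
                                                            (^ᴳ-congˡ (quotient p∣c) (witness^p j))))

-- Shortest walks of length at most two

module Walks {a : Level} {n : ℕ} (Adj : Fin n → Fin n → Set a) where
  open Graph Adj

  walk₀⇒≡ : ∀ {x y} → Walk x y 0 → x ≡ y
  walk₀⇒≡ here = ≡.refl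

  walk₁⇒Adj : ∀ {x y} → Walk x y 1 → Adj x y
  walk₁⇒Adj (step x∼y here) = x∼y

  shortestThrough-start : ∀ {x y k} (w : Walk x y k) → IsShortest w → ShortestThrough x y x
  shortestThrough-start here           shortest = 0 , here , shortest , here ≡.refl
  shortestThrough-start w@(step _ _)   shortest = _ , w , shortest , here ≡.refl

  twoStep-shortest : ∀ {z j i} (z∼j : Adj z j) (j∼i : Adj j i) → z ≢ i → ¬ Adj z i →
                     IsShortest (step z∼j (step j∼i here))
  twoStep-shortest _ _ z≢i _   zero          w = contradiction (walk₀⇒≡ w) z≢i
  twoStep-shortest _ _ _   z≁i (suc zero)    w = contradiction (walk₁⇒Adj w) z≁i
  twoStep-shortest _ _ _   _   (suc (suc k)) _ = s≤s (s≤s z≤n)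

  shortestThrough-midpoint : ∀ {z j i} → Adj z j → Adj j i → z ≢ i → ¬ Adj z i →
                             ShortestThrough z i j
  shortestThrough-midpoint z∼j j∼i z≢i z≁i =
    2 , step z∼j (step j∼i here) , twoStep-shortest z∼j j∼i z≢i z≁i , there (here ≡.refl)

  midpoint-of-shortest : ∀ {z i j k} (w : Walk z i k) → IsShortest w → k ≤ 2 →
                         j List.∈ vertices w → z ≢ j → j ≢ i → Adj z j × Adj j i × ¬ Adj z i
  midpoint-of-shortest here                      _ _ (here j≡z) z≢j _ = contradiction (≡.sym j≡z) z≢j
  midpoint-of-shortest (step _ here)             _ _ (here j≡z) z≢j _ = contradiction (≡.sym j≡z) z≢j
  midpoint-of-shortest (step _ here)             _ _ (there (here j≡i)) _ j≢i = contradiction j≡i j≢i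
  midpoint-of-shortest (step _ (step _ here))    _ _ (here j≡z) z≢j _ = contradiction (≡.sym j≡z) z≢j
  midpoint-of-shortest (step z∼j (step j∼i here)) shortest _ (there (here ≡.refl)) _ _ =
    z∼j , j∼i , λ z∼i → 1+n≰n (shortest 1 (step z∼i here))
  midpoint-of-shortest (step _ (step _ here))    _ _ (there (there (here j≡i))) _ j≢i = contradiction j≡i j≢i
  midpoint-of-shortest (step _ (step _ (step _ _))) _ (s≤s (s≤s ())) _ _ _

  module WithDominatingVertex (Adj? : Decidable₂ Adj) (Adj-sym : ∀ {x y} → Adj x y → Adj y x)
                              (u : Fin n) (u-dominating : ∀ {v} → u ≢ v → Adj u v) where

    shortestWalk : ∀ {x y} → x ≢ y → ∃ λ k → k ≤ 2 × Σ (Walk x y k) IsShortest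
    shortestWalk {x} {y} x≢y with Adj? x y
    ... | yes x∼y = 1 , s≤s z≤n , step x∼y here , shortest
      where
      shortest : ∀ k → Walk x y k → 1 ≤ k
      shortest zero    w = contradiction (walk₀⇒≡ w) x≢y
      shortest (suc _) _ = s≤s z≤n
    ... | no x≁y = 2 , ≤-refl , step x∼u (step u∼y here) , twoStep-shortest x∼u u∼y x≢y x≁y
      where
      x≢u : x ≢ u
      x≢u ≡.refl = x≁y (u-dominating x≢y)
      u≢y : u ≢ y
      u≢y ≡.refl = x≁y (Adj-sym (u-dominating (x≢y ∘ ≡.sym)))
      x∼u : Adj x u
      x∼u = Adj-sym (u-dominating (x≢u ∘ ≡.sym))
      u∼y : Adj u y
      u∼y = u-dominating u≢y

    shortestThrough-self : ∀ {x y} → x ≢ y → ShortestThrough x y x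
    shortestThrough-self x≢y with _ , _ , w , shortest ← shortestWalk x≢y =
      shortestThrough-start w shortest

    shortestThrough⇒midpoint : ∀ {z i j} → ShortestThrough z i j → z ≢ i → z ≢ j → j ≢ i →
                               Adj z j × Adj j i × ¬ Adj z i
    shortestThrough⇒midpoint (k , w , shortest , j∈w) z≢i
      with k₀ , k₀≤2 , w₀ , _ ← shortestWalk z≢i =
      midpoint-of-shortest w shortest (≤-trans (shortest k₀ w₀) k₀≤2) j∈w

-- The enhanced power graph of a finite abelian p-group

module EnhancedPowerGraph {c ℓ : Level} (G : AbelianGroup c ℓ) {n : ℕ} (E : Enumeration G n) where
  open AbelianGroup G
  open Enumeration E
  open CyclicSubgroups G
  open Graph (EnhancedPowerAdj G E)
  open Walks (EnhancedPowerAdj G E)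

  Adj : Fin n → Fin n → Set (c ⊔ ℓ)
  Adj = EnhancedPowerAdj G E

  index : Carrier → Fin n
  index x = proj₁ (surj x)

  elem-index : ∀ x → elem (index x) ≈ x
  elem-index x = proj₂ (surj x)

  index-injective : ∀ {x y} → index x ≡ index y → x ≈ y
  index-injective {x} {y} eq =
    trans (sym (elem-index x)) (trans (reflexive (≡.cong elem eq)) (elem-index y))

  _≈?_ : Decidable₂ _≈_
  x ≈? y = map′ index-injective
                (λ x≈y → inj _ _ (trans (elem-index x) (trans x≈y (sym (elem-index y)))))
                (index x ≟ index y)

  ¬∀⇒∃¬ : ∀ {b} {P : Carrier → Set b} → (∀ x → Dec (P x)) → (∀ {x y} → x ≈ y → P x → P y) →
          ¬ (∀ x → P x) → ∃ λ x → ¬ P x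
  ¬∀⇒∃¬ {P = P} P? P-resp ¬∀P
    with i , ¬Pi ← ¬∀⟶∃¬ n (P ∘ elem) (P? ∘ elem)
                           (λ all → ¬∀P λ x → P-resp (elem-index x) (all (index x))) =
    elem i , ¬Pi

  Adj-sym : ∀ {i j} → Adj i j → Adj j i
  Adj-sym (i≢j , cp) = i≢j ∘ ≡.sym , cyclicPair-sym cp

  identity-dominating : ∀ {j} → index ε ≢ j → Adj (index ε) j
  identity-dominating ε≢j = ε≢j , ∈⟨⟩⇒cyclicPair (∈⟨⟩-respˡ (sym (elem-index ε)) (ε∈⟨⟩ _))

  ∈∧∉⇒≢ : ∀ {S : Subset n} {i j} → i ∈ S → j ∉ S → i ≢ j
  ∈∧∉⇒≢ i∈S j∉S ≡.refl = j∉S i∈S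

  module OfPGroup (p : ℕ) (p-prime : Prime p) (m : ℕ) (torsion : ∀ x → x ^ᴳ (p ^ m) ≈ ε) where
    open PGroup p p-prime m torsion
    open Height _≈?_

    cyclicPair? : ∀ x y → Dec (CyclicPair G x y)
    cyclicPair? x y = map′ [ ∈⟨⟩⇒cyclicPair , cyclicPair-sym ∘ ∈⟨⟩⇒cyclicPair ]′ cyclicPair⇒comparable
                           (∈⟨⟩? _≈?_ x y ⊎-dec ∈⟨⟩? _≈?_ y x)

    Adj? : Decidable₂ Adj
    Adj? i j with i ≟ j
    ... | yes i≡j = no λ (i≢j , _) → i≢j i≡j
    ... | no i≢j  = map′ (i≢j ,_) proj₂ (cyclicPair? (elem i) (elem j))

    open WithDominatingVertex Adj? Adj-sym (index ε) identity-dominating public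

    resolvedOutside⇒height≢ : ∀ {z i j} → ShortestThrough z i j → z ≢ i → z ≢ j → j ≢ i →
                              height (elem i) ≢ height (elem j)
    resolvedOutside⇒height≢ st z≢i z≢j j≢i hi≡hj
      with (_ , zj-cyclic) , (_ , ji-cyclic) , z≁i ← shortestThrough⇒midpoint st z≢i z≢j j≢i
      with j∈⟨i⟩ , i∈⟨j⟩ ← cyclicPair∧height≡⇒twins ji-cyclic (≡.sym hi≡hj) =
      z≁i (z≢i , cyclicPair-twin j∈⟨i⟩ i∈⟨j⟩ zj-cyclic)

    height-injectiveOutside : ∀ {S} → IsStrongResolvingSet S → ∀ {i j} → i ∉ S → j ∉ S →
                              height (elem i) ≡ height (elem j) → i ≡ j
    height-injectiveOutside resolving {i} {j} i∉S j∉S hi≡hj with i ≟ j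
    ... | yes i≡j = i≡j
    ... | no i≢j with resolving i j i≢j
    ...   | z , z∈S , inj₁ st = contradiction hi≡hj
              (resolvedOutside⇒height≢ st (∈∧∉⇒≢ z∈S i∉S) (∈∧∉⇒≢ z∈S j∉S) (i≢j ∘ ≡.sym))
    ...   | z , z∈S , inj₂ st = contradiction (≡.sym hi≡hj)
              (resolvedOutside⇒height≢ st (∈∧∉⇒≢ z∈S j∉S) (∈∧∉⇒≢ z∈S i∉S) i≢j)

    sdim-lower : ∀ {S} → IsStrongResolvingSet S → n ∸ suc m ≤ ∣ S ∣
    sdim-lower {S} resolving = begin
      n ∸ suc m         ≤⟨ ∸-monoʳ-≤ n ∣∁S∣≤1+m ⟩
      n ∸ ∣ ∁ S ∣       ≡⟨ ≡.cong (n ∸_) (∣∁p∣≡n∸∣p∣ S) ⟩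
      n ∸ (n ∸ ∣ S ∣)   ≡⟨ m∸[m∸n]≡n (∣p∣≤n S) ⟩
      ∣ S ∣             ∎
      where
      open ≤-Reasoning
      heightFin : Fin n → Fin (suc m)
      heightFin i = fromℕ< (s≤s (height≤m (elem i)))
      ∣∁S∣≤1+m : ∣ ∁ S ∣ ≤ suc m
      ∣∁S∣≤1+m = injectiveOn⇒∣p∣≤ (∁ S) (λ {i} _ → heightFin i) λ i∈∁S j∈∁S eq →
        height-injectiveOutside resolving (x∈∁p⇒x∉p i∈∁S) (x∈∁p⇒x∉p j∈∁S)
          (fromℕ<-injective _ _ (s≤s (height≤m _)) (s≤s (height≤m _)) eq)

  module ChainComplement (p : ℕ) (p-prime : Prime p) (m′ : ℕ)
                         (torsion : ∀ x → x ^ᴳ (p ^ suc m′) ≈ ε)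
                         (g : Carrier) (g-maximal : ¬ g ^ᴳ (p ^ m′) ≈ ε)
                         {h : Carrier} (hᵖ≈ε : h ^ᴳ p ≈ ε) (h∉⟨g⟩ : ¬ h ∈⟨ g ⟩) where
    open OfPGroup p p-prime (suc m′) torsion using (shortestThrough-self)
    open MaximalChain p p-prime m′ torsion g g-maximal
    open Witness hᵖ≈ε h∉⟨g⟩

    vertex : ℕ → Fin n
    vertex k = index (g ^ᴳ (p ^ k))

    vertex-∈⟨g⟩ : ∀ k → elem (vertex k) ∈⟨ g ⟩
    vertex-∈⟨g⟩ k = ∈⟨⟩-respˡ (sym (elem-index _)) (^ᴳ∈⟨⟩ g (p ^ k))

    chainVertex : Fin (suc (suc m′)) → Fin n
    chainVertex = vertex ∘ toℕ

    chainVertex-injective : Injective _≡_ _≡_ chainVertex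
    chainVertex-injective {a} {b} eq =
      toℕ-injective (chain-injective (toℕ≤pred[n] a) (toℕ≤pred[n] b) (index-injective eq))

    chainᶜ : Subset n
    chainᶜ = ∁ (image chainVertex)

    ∉⟨g⟩⇒∈chainᶜ : ∀ {i} → ¬ elem i ∈⟨ g ⟩ → i ∈ chainᶜ
    ∉⟨g⟩⇒∈chainᶜ i∉⟨g⟩ = x∉p⇒x∈∁p λ i∈chain → i∉⟨g⟩ (chain-∈⟨g⟩ (∈-image⁻ chainVertex i∈chain))
      where
      chain-∈⟨g⟩ : ∀ {i} → (∃ λ k → i ≡ chainVertex k) → elem i ∈⟨ g ⟩
      chain-∈⟨g⟩ (k , ≡.refl) = vertex-∈⟨g⟩ (toℕ k)

    ∣chainᶜ∣≤ : ∣ chainᶜ ∣ ≤ n ∸ suc (suc m′)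
    ∣chainᶜ∣≤ = begin
      ∣ chainᶜ ∣                   ≡⟨ ∣∁p∣≡n∸∣p∣ (image chainVertex) ⟩
      n ∸ ∣ image chainVertex ∣   ≤⟨ ∸-monoʳ-≤ n (injective⇒≤∣p∣ (image chainVertex) chainVertex
                                                    chainVertex-injective (∈-image⁺ chainVertex)) ⟩
      n ∸ suc (suc m′)             ∎
      where open ≤-Reasoning

    chain-resolved : ∀ {a b} → a < b → b ≤ suc m′ →
                     ∃ λ z → z ∈ chainᶜ × ShortestThrough z (vertex a) (vertex b)
    chain-resolved {a} {suc j} (s≤s a≤j) (s≤s j≤m′) =
      z , ∉⟨g⟩⇒∈chainᶜ z∉⟨g⟩ , shortestThrough-midpoint z∼b b∼a (z≢vertex a) z≁a
      where
      z : Fin n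
      z = index (witness j)
      z∉⟨g⟩ : ¬ elem z ∈⟨ g ⟩
      z∉⟨g⟩ = witness∉⟨g⟩ j ∘ ∈⟨⟩-respˡ (elem-index _)
      z≢vertex : ∀ k → z ≢ vertex k
      z≢vertex k z≡ = z∉⟨g⟩ (≡.subst (λ i → elem i ∈⟨ g ⟩) (≡.sym z≡) (vertex-∈⟨g⟩ k))
      z∼b : Adj z (vertex (suc j))
      z∼b = z≢vertex (suc j) , cyclicPair-sym (∈⟨⟩⇒cyclicPair
              (∈⟨⟩-resp (sym (elem-index _)) (sym (elem-index _)) (p , sym (witness^p j))))
      b≢a : vertex (suc j) ≢ vertex a
      b≢a eq = 1+n≰n (≤-trans (≤-reflexive (chain-injective (s≤s j≤m′) (≤-trans a≤j (m≤n⇒m≤1+n j≤m′))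
                                                             (index-injective eq))) a≤j)
      b∼a : Adj (vertex (suc j)) (vertex a)
      b∼a = b≢a , ∈⟨⟩⇒cyclicPair (∈⟨⟩-resp (sym (elem-index _)) (sym (elem-index _))
                                   (^ᴳ^-∈⟨^ᴳ^⟩ g p (m≤n⇒m≤1+n a≤j)))
      z≁a : ¬ Adj z (vertex a)
      z≁a (_ , za-cyclic) =
        witness-nonadjacent a≤j j≤m′ (cyclicPair-resp (elem-index _) (elem-index _) za-cyclic)

    chainᶜ-resolving : IsStrongResolvingSet chainᶜ
    chainᶜ-resolving x y x≢y with x ∈? chainᶜ | y ∈? chainᶜ
    ... | yes x∈ | _      = x , x∈ , inj₂ (shortestThrough-self x≢y)
    ... | no _   | yes y∈ = y , y∈ , inj₁ (shortestThrough-self (x≢y ∘ ≡.sym))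
    ... | no x∉  | no y∉
      with a , ≡.refl ← ∈-image⁻ chainVertex (x∉∁p⇒x∈p x∉)
         | b , ≡.refl ← ∈-image⁻ chainVertex (x∉∁p⇒x∈p y∉)
      with <-cmp (toℕ a) (toℕ b)
    ... | tri< a<b _ _ = map₂ (map₂ inj₁) (chain-resolved a<b (toℕ≤pred[n] b))
    ... | tri≈ _ a≡b _ = contradiction (≡.cong chainVertex (toℕ-injective a≡b)) x≢y
    ... | tri> _ _ b<a = map₂ (map₂ inj₂) (chain-resolved b<a (toℕ≤pred[n] a))

  module NonCyclic (p : ℕ) (p-prime : Prime p) (m′ : ℕ) (exponent : IsExponent G (p ^ suc m′))
                   (¬cyclic : ¬ IsCyclic G) where
    torsion : ∀ x → x ^ᴳ (p ^ suc m′) ≈ ε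
    torsion = proj₁ (proj₂ exponent)

    open PGroup p p-prime (suc m′) torsion using (∈⟨⟩?; p≢0; p-nontrivial)
    open OfPGroup p p-prime (suc m′) torsion using (sdim-lower)

    maximal : ∃ λ g → ¬ g ^ᴳ (p ^ m′) ≈ ε
    maximal = ¬∀⇒∃¬ (λ x → (x ^ᴳ (p ^ m′)) ≈? ε) (λ x≈y → trans (^ᴳ-congˡ (p ^ m′) (sym x≈y)))
      λ all → <⇒≱ (^-monoʳ-< p (nonTrivial⇒n>1 p) (n<1+n m′))
                  (proj₂ (proj₂ exponent) _ (m^n>0 p m′) all)

    g : Carrier
    g = proj₁ maximal

    g-maximal : ¬ g ^ᴳ (p ^ m′) ≈ ε
    g-maximal = proj₂ maximal

    open MaximalChain p p-prime m′ torsion g g-maximal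

    beyond-g : ∃ λ y → ¬ y ∈⟨ g ⟩
    beyond-g = ¬∀⇒∃¬ (λ x → ∈⟨⟩? _≈?_ x g) ∈⟨⟩-respˡ (λ all → ¬cyclic (g , all))

    orderP : ∃ λ h → h ^ᴳ p ≈ ε × ¬ h ∈⟨ g ⟩
    orderP = ∉⟨g⟩⇒∃orderP _≈?_ (proj₂ beyond-g)

    open ChainComplement p p-prime m′ torsion g g-maximal (proj₁ (proj₂ orderP)) (proj₂ (proj₂ orderP))

    sdim : Graph.IsSDim Adj (n ∸ suc (suc m′))
    sdim = (chainᶜ , chainᶜ-resolving , ≤-antisym ∣chainᶜ∣≤ (sdim-lower chainᶜ-resolving)) ,
           λ _ → sdim-lower

proposition4p8 : ∀ {c ℓ : Level} (p : ℕ) → Prime p →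
    (G : AbelianGroup c ℓ) (n : ℕ) (E : Enumeration G n) →
    (∃[ k ] (n ≡ p ^ k)) →
    (m : ℕ) → IsExponent G (p ^ m) →
    ¬ IsCyclic G →
    sdimEnhancedPower G E (n ∸ (m + 1))
proposition4p8 p p-prime G n E _ zero (_ , torsion , _) ¬cyclic =
  contradiction (ε , λ x → 0 , trans (sym (identityʳ x)) (torsion x)) ¬cyclic
  where open AbelianGroup G
proposition4p8 p p-prime G n E _ (suc m′) exponent ¬cyclic =
  ≡.subst (sdimEnhancedPower G E) (≡.cong (n ∸_) (+-comm 1 (suc m′))) sdim
  where open EnhancedPowerGraph.NonCyclic G E p p-prime m′ exponent ¬cyclic
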